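{- Let $T$ be a finite labelled rooted tree, $V=\{[u]_\sim:u\in T\}$, $S=[\mathrm{root}(T)]_\sim$, and let $s:V\to T$ be an injective map with $[s(a)]_\sim=a$ for all $a\in V$ such that every $q\neq S$ admits some $p\in V$ with $(p,q)$ an edge of $G$ and $s(q)\in\mathrm{children}(s(p))$. Let $\mathcal{R}(T)$ (the DAG-RW compression) be the multigraph with vertex set $V$, vertex labels $L_V(q)=\overline{s(q)}$, and edges the triples $(p,q,v)$ with $p,q\in V$, $v\in\mathrm{children}(s(p))$, $[v]_\sim=q$, each carrying the label $L_E(p,q,v)=f_\phi:\mathrm{attr}(T(s(q)))\to\mathrm{attr}(T(v))$, the cipher of a chosen tree ciphering $\phi$ from $T(s(q))$ onto $T(v)$ (the identity when $v=s(q)$). Then $\mathcal{R}(T)$ is a lossless compression of $T$: let $\widehat{T}$ be the labelled rooted tree whose nodes are the finite paths of edges $(e_1,\dots,e_m)$ in $\mathcal{R}(T)$ starting at $S$ ($m\geq 0$; the empty path is the root), where the children of a path ending at vertex $p$ are its extensions by one edge leaving $p$, and where the label of the empty path is $L_V(S)$ and the label of a path $(e_1,\dots,e_m)$, $m\geq1$, ending at vertex $p_m$ is $\big(L_E(e_1)\circ\cdots\circ L_E(e_m)\big)(L_V(p_m))$. Then there is a labelled tree isomorphism between $\widehat{T}$ and $T$ (a bijection preserving the parent–child relation and the labels).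
   Context: A labelled rooted tree $T$ is a finite rooted tree (edges directed from parent to child), each node $u$ carrying a label $\overline{u}$; $\mathrm{attr}(T)=\{\overline{u}:u\in T\}$; $\mathrm{children}(u)$ is the set of children of $u$ and $T(u)$ is the labelled subtree formed by $u$ and its descendants. A tree isomorphism $\phi:T_1\to T_2$ is a bijection on nodes such that $u$ is a child of $v$ iff $\phi(u)$ is a child of $\phi(v)$; it is a tree ciphering if there is a bijection $f_\phi:\mathrm{attr}(T_1)\to\mathrm{attr}(T_2)$ (the cipher) with $\overline{\phi(u)}=f_\phi(\overline{u})$ for all $u\in T_1$. $T_1\sim T_2$ means a tree ciphering exists (an equivalence relation); $[u]_\sim$ is the class of $T(u)$. $G$ denotes the directed multigraph on $V$ in which $(p,q)$ has multiplicity equal to the largest $k$ such that some node $u$ with $[u]_\sim=p$ has $k$ distinct children of class $q$; $S$ is its unique source. -}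

module Defs where

open import Data.Nat using (ℕ)
open import Data.Fin using (Fin)
open import Data.List using (List; length; lookup)
open import Data.Product using (Σ; _×_; _,_)
open import Relation.Binary.PropositionalEquality using (_≡_)
open import Function.Bundles using (_⇔_; _⤖_; Bijection)
open import Function using (id; _∘_)

-- Finite labelled rooted trees (rose trees); children are listed in some order,
-- but all notions below (isomorphism, ciphering) ignore that order.
data Tree (A : Set) : Set where
  node : A → List (Tree A) → Tree A

module _ {A : Set} where

  rootLabel : Tree A → A
  rootLabel (node a _) = a

  subtrees : Tree A → List (Tree A)
  subtrees (node _ ts) = ts

  -- Nodes of a tree t: positions (paths from the root).
  data Pos : Tree A → Set where
    here  : ∀ {t} → Pos t
    there : ∀ {a ts} (j : Fin (length ts)) → Pos (lookup ts j) → Pos (node a ts)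

  root : (t : Tree A) → Pos t
  root t = here

  subtree : ∀ {t} → Pos t → Tree A
  subtree {t} here = t
  subtree (there j u) = subtree u

  lab : ∀ {t} → Pos t → A
  lab u = rootLabel (subtree u)

  arity : ∀ {t} → Pos t → ℕ
  arity u = length (subtrees (subtree u))

  childPos : ∀ {t} (u : Pos t) → Fin (arity u) → Pos t
  childPos {node a ts} here i = there i here
  childPos (there j u) i = there j (childPos u i)

  ChildOf : ∀ {t} → Pos t → Pos t → Set
  ChildOf v u = Σ (Fin (arity u)) λ i → childPos u i ≡ v

  -- A tree ciphering from t₁ onto t₂: a tree isomorphism φ together with a
  -- cipher, i.e. a bijection attr(t₁) → attr(t₂) given as a function A → A
  -- that is injective on attr(t₁) and satisfies  label(φ u) = f(label u)
  -- (so it maps attr(t₁) onto attr(t₂), since φ is onto).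
  record Ciphering (t₁ t₂ : Tree A) : Set where
    field
      iso        : Pos t₁ ⤖ Pos t₂
    φ : Pos t₁ → Pos t₂
    φ = Bijection.to iso
    field
      child-pres : ∀ u v → ChildOf u v ⇔ ChildOf (φ u) (φ v)
      cipher     : A → A
      cipher-inj : ∀ (u v : Pos t₁) → cipher (lab u) ≡ cipher (lab v) → lab u ≡ lab v
      lab-pres   : ∀ u → lab (φ u) ≡ cipher (lab u)

  -- (p , q) is an edge of G (multiplicity ≥ 1): some node u of class p has a
  -- child of class q.
  GEdge : (t : Tree A) {V : Set} → (Pos t → V) → V → V → Set
  GEdge t cls p q =
    Σ (Pos t) λ u → (cls u ≡ p) × (Σ (Fin (arity u)) λ i → cls (childPos u i) ≡ q)

  -- An edge (p, q, v) of R(T) is encoded as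
  -- (p , i) with v = childPos (s p) i and q = cls v; its label is (the cipher
  -- of) a chosen ciphering from T(s q) onto T(v).
  Choice : (t : Tree A) {V : Set} → (Pos t → V) → (V → Pos t) → Set
  Choice t {V} cls s = (p : V) (i : Fin (arity (s p))) →
    Ciphering (subtree (s (cls (childPos (s p) i)))) (subtree (childPos (s p) i))

  module Unfold (t : Tree A) {V : Set} (cls : Pos t → V) (s : V → Pos t)
                (L : Choice t cls s) where

    S : V
    S = cls (root t)

    data Path : Set
    end : Path → V

    data Path where
      []  : Path
      _▷_ : (π : Path) → Fin (arity (s (end π))) → Path

    end [] = S
    end (π ▷ i) = cls (childPos (s (end π)) i)

    comp : Path → A → A
    comp [] = id
    comp (π ▷ i) = comp π ∘ Ciphering.cipher (L (end π) i)

    LV : V → A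
    LV q = lab (s q)

    labHat : Path → A
    labHat π = comp π (LV (end π))

    ChildHat : Path → Path → Set
    ChildHat ρ π = Σ (Fin (arity (s (end π)))) λ i → (π ▷ i) ≡ ρ

-- Every path π of R(T) from S to p yields an embedding of T(s p) into T that
-- transforms labels by the composite cipher of π: each edge (p, i) composes
-- with the chosen ciphering onto the i-th child of s p. Such embeddings
-- preserve children and are onto the children of every image node, so
-- evaluating them at the root gives a labelled isomorphism T̂ ≅ T, provided
-- s S is the root of T. That holds because no tree is ciphered onto a proper
-- subtree of itself: a ciphering preserves depth, so following it by the
-- descent into the subtree strictly increases depth, and iterating this map
-- would produce nodes deeper than the height of T.
module Submission where

open import Defs
open import Data.Empty using (⊥-elim)
open import Data.Fin using (Fin)
import Data.Fin as Fin
open import Data.List using (List; []; _∷_; length; lookup)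
open import Data.Nat using (ℕ; zero; suc; _+_; _≤_; _<_; _⊔_; s≤s; z≤n)
open import Data.Nat.Properties using (≤-trans; m≤n+m; m≤m⊔n; m≤n⊔m; <-irrefl)
open import Data.Product using (Σ; _×_; ∃; _,_)
open import Function using (id; _∘_)
open import Function.Bundles using (_⇔_; _⤖_; Bijection; Equivalence; mk⤖; mk⇔)
open import Relation.Binary.PropositionalEquality
  using (_≡_; _≢_; refl; sym; trans; cong; subst; module ≡-Reasoning)

module _ {A : Set} where

  there-injectiveˡ : ∀ {a : A} {ts} {i j : Fin (length ts)} {x y} →
    _≡_ {A = Pos (node a ts)} (there i x) (there j y) → i ≡ j
  there-injectiveˡ refl = refl

  there-injective : ∀ {a : A} {ts} {j : Fin (length ts)} {x y : Pos (lookup ts j)} →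
    _≡_ {A = Pos (node a ts)} (there j x) (there j y) → x ≡ y
  there-injective refl = refl

  childPos≢here : ∀ {t : Tree A} (u : Pos t) i → childPos u i ≢ here
  childPos≢here {node _ _} here i ()
  childPos≢here (there j u) i ()

  childPos-injectiveˡ : ∀ {t : Tree A} (u u' : Pos t) i i' →
    childPos u i ≡ childPos u' i' → u ≡ u'
  childPos-injectiveˡ {node _ _} here here i i' e = refl
  childPos-injectiveˡ {node _ _} here (there j u') i i' e with there-injectiveˡ e
  ... | refl = ⊥-elim (childPos≢here u' i' (sym (there-injective e)))
  childPos-injectiveˡ {node _ _} (there j u) here i i' e with there-injectiveˡ e
  ... | refl = ⊥-elim (childPos≢here u i (there-injective e))
  childPos-injectiveˡ {node _ _} (there j u) (there j' u') i i' e with there-injectiveˡ e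
  ... | refl = cong (there j) (childPos-injectiveˡ u u' i i' (there-injective e))

  childPos-injectiveʳ : ∀ {t : Tree A} (u : Pos t) i i' →
    childPos u i ≡ childPos u i' → i ≡ i'
  childPos-injectiveʳ {node _ _} here i i' e = there-injectiveˡ e
  childPos-injectiveʳ (there j u) i i' e = childPos-injectiveʳ u i i' (there-injective e)

  -- Pos t is built by prepending the first step from the root, whereas childPos
  -- appends the last one; this view lets us induct in the latter direction.
  data Descent {t : Tree A} : Pos t → Set where
    from-root : Descent here
    _▷_       : ∀ {u} → Descent u → (i : Fin (arity u)) → Descent (childPos u i)

  there-descent : ∀ {a : A} {ts} (j : Fin (length ts)) {u : Pos (lookup ts j)} →
    Descent u → Descent {node a ts} (there j u)
  there-descent j from-root = from-root ▷ j
  there-descent j (d ▷ i) = there-descent j d ▷ i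

  descent : ∀ {t : Tree A} (u : Pos t) → Descent u
  descent here = from-root
  descent (there j u) = there-descent j (descent u)

  record Embedding (t₁ t₂ : Tree A) (c : A → A) (f : Pos t₁ → Pos t₂) : Set where
    field
      injective       : ∀ {x y} → f x ≡ f y → x ≡ y
      preserves-child : ∀ {v u} → ChildOf v u → ChildOf (f v) (f u)
      lifts-child     : ∀ {v u} → ChildOf v (f u) → Σ (Pos t₁) λ w → ChildOf w u × f w ≡ v
      relabels        : ∀ x → lab (f x) ≡ c (lab x)

  open Embedding

  id-embedding : ∀ {t} → Embedding t t id id
  id-embedding = record
    { injective       = id
    ; preserves-child = id
    ; lifts-child     = λ {v} v∈u → v , v∈u , refl
    ; relabels        = λ _ → refl
    }

  ∘-embedding : ∀ {t₁ t₂ t₃ c d f g} →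
    Embedding t₂ t₃ c g → Embedding t₁ t₂ d f → Embedding t₁ t₃ (c ∘ d) (g ∘ f)
  ∘-embedding {c = c} {f = f} {g = g} G F = record
    { injective       = injective F ∘ injective G
    ; preserves-child = preserves-child G ∘ preserves-child F
    ; lifts-child     = λ v∈gfu →
        let (w₁ , w₁∈fu , gw₁≡v) = lifts-child G v∈gfu
            (w₂ , w₂∈u , fw₂≡w₁) = lifts-child F w₁∈fu
        in w₂ , w₂∈u , trans (cong g fw₂≡w₁) gw₁≡v
    ; relabels        = λ x → trans (relabels G (f x)) (cong c (relabels F x))
    }

  subst-embedding : ∀ {t : Tree A} {u v : Pos t} (e : u ≡ v) →
    Embedding (subtree u) (subtree v) id (subst (Pos ∘ subtree) e)
  subst-embedding refl = id-embedding

  subst-here : ∀ {t : Tree A} {u v : Pos t} (e : u ≡ v) → subst (Pos ∘ subtree) e here ≡ here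
  subst-here refl = refl

  there-embedding : ∀ {a : A} {ts} (j : Fin (length ts)) →
    Embedding (lookup ts j) (node a ts) id (there j)
  there-embedding j = record
    { injective       = there-injective
    ; preserves-child = λ (i , e) → i , cong (there j) e
    ; lifts-child     = λ {v} {u} (i , e) → childPos u i , (i , refl) , e
    ; relabels        = λ _ → refl
    }

  descend : ∀ {t : Tree A} (u : Pos t) (i : Fin (arity u)) →
    Pos (subtree (childPos u i)) → Pos (subtree u)
  descend {node _ _} here i = there i
  descend (there j u) i = descend u i

  descend-embedding : ∀ {t : Tree A} (u : Pos t) i →
    Embedding (subtree (childPos u i)) (subtree u) id (descend u i)
  descend-embedding {node _ _} here i = there-embedding i
  descend-embedding (there j u) i = descend-embedding u i

  descend-here : ∀ {t : Tree A} (u : Pos t) i →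
    descend u i here ≡ childPos {t = subtree u} here i
  descend-here {node _ _} here i = refl
  descend-here (there j u) i = descend-here u i

  depth : ∀ {t : Tree A} → Pos t → ℕ
  depth here = 0
  depth (there j u) = suc (depth u)

  depth-childPos : ∀ {t : Tree A} (u : Pos t) i → depth (childPos u i) ≡ suc (depth u)
  depth-childPos {node _ _} here i = refl
  depth-childPos (there j u) i = cong suc (depth-childPos u i)

  height : Tree A → ℕ
  heights : List (Tree A) → ℕ
  height (node _ ts) = suc (heights ts)
  heights [] = 0
  heights (t ∷ ts) = height t ⊔ heights ts

  height-lookup≤heights : ∀ (ts : List (Tree A)) j → height (lookup ts j) ≤ heights ts
  height-lookup≤heights (t ∷ ts) Fin.zero = m≤m⊔n (height t) (heights ts)
  height-lookup≤heights (t ∷ ts) (Fin.suc j) =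
    ≤-trans (height-lookup≤heights ts j) (m≤n⊔m (height t) (heights ts))

  depth<height : ∀ {t : Tree A} (x : Pos t) → depth x < height t
  depth<height {node _ _} here = s≤s z≤n
  depth<height {node _ ts} (there j x) =
    s≤s (≤-trans (depth<height x) (height-lookup≤heights ts j))

  graft : ∀ {t : Tree A} (u : Pos t) → Pos (subtree u) → Pos t
  graft here w = w
  graft (there j u) w = there j (graft u w)

  depth-graft : ∀ {t : Tree A} (u : Pos t) w → depth (graft u w) ≡ depth u + depth w
  depth-graft here w = refl
  depth-graft (there j u) w = cong suc (depth-graft u w)

  module _ {t₁ t₂ : Tree A} (C : Ciphering t₁ t₂) where
    open Ciphering C
    open Bijection iso using (surjective)
    open ≡-Reasoning

    ciphering-embedding : Embedding t₁ t₂ cipher φ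
    ciphering-embedding = record
      { injective       = Bijection.injective iso
      ; preserves-child = Equivalence.to (child-pres _ _)
      ; lifts-child     = λ {v} {u} v∈φu →
          let (w , φw≡v) = surjective v
              e = φw≡v refl
          in w , Equivalence.from (child-pres w u) (subst (λ z → ChildOf z (φ u)) (sym e) v∈φu) , e
      ; relabels        = lab-pres
      }

    -- The root is the only node without a parent, and φ preserves parents.
    ciphering-here : φ here ≡ here
    ciphering-here with surjective here
    ... | w , φw≡here with descent w
    ...   | from-root = φw≡here refl
    ...   | _▷_ {u} _ i =
            let (k , e) = Equivalence.to (child-pres (childPos u i) u) (i , refl)
            in ⊥-elim (childPos≢here (φ u) k (trans e (φw≡here refl)))

    ciphering-depth : ∀ x → depth (φ x) ≡ depth x
    ciphering-depth x = go (descent x)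
      where
      go : ∀ {x} → Descent x → depth (φ x) ≡ depth x
      go from-root = cong depth ciphering-here
      go (_▷_ {u} d i) =
        let (k , e) = Equivalence.to (child-pres (childPos u i) u) (i , refl)
        in begin
             depth (φ (childPos u i))  ≡⟨ cong depth (sym e) ⟩
             depth (childPos (φ u) k)  ≡⟨ depth-childPos (φ u) k ⟩
             suc (depth (φ u))         ≡⟨ cong suc (go d) ⟩
             suc (depth u)             ≡⟨ depth-childPos u i ⟨
             depth (childPos u i)      ∎

  ciphering-onto-subtree⇒here : ∀ {t : Tree A} (u : Pos t) → Ciphering t (subtree u) → u ≡ here
  ciphering-onto-subtree⇒here here C = refl
  ciphering-onto-subtree⇒here {t@(node _ _)} (there j w) C =
    ⊥-elim (<-irrefl refl (≤-trans (depth<height (iterate (height t))) (depth-iterate (height t))))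
    where
    deeper : Pos t → Pos t
    deeper x = graft (there j w) (Ciphering.φ C x)

    depth-deeper : ∀ x → depth (deeper x) ≡ suc (depth w + depth x)
    depth-deeper x = trans (depth-graft {t} (there j w) (Ciphering.φ C x))
                           (cong (λ n → suc (depth w + n)) (ciphering-depth C x))

    iterate : ℕ → Pos t
    iterate zero = here
    iterate (suc n) = deeper (iterate n)

    depth-iterate : ∀ n → n ≤ depth (iterate n)
    depth-iterate zero = z≤n
    depth-iterate (suc n) rewrite depth-deeper (iterate n) =
      s≤s (≤-trans (depth-iterate n) (m≤n+m _ (depth w)))

open Embedding

module Unfolding {A : Set} (t : Tree A) {V : Set} (cls : Pos t → V)
  (cls≡⇔ciphering : ∀ u v → (cls u ≡ cls v) ⇔ Ciphering (subtree u) (subtree v))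
  (s : V → Pos t) (cls∘s : ∀ a → cls (s a) ≡ a) (L : Choice t cls s) where

  open Unfold t cls s L

  s-S≡here : s S ≡ here
  s-S≡here = ciphering-onto-subtree⇒here (s S)
    (Equivalence.to (cls≡⇔ciphering here (s S)) (sym (cls∘s S)))

  embed : (π : Path) → Pos (subtree (s (end π))) → Pos t
  embed [] = subst (Pos ∘ subtree) s-S≡here
  embed (π ▷ i) = embed π ∘ descend (s (end π)) i ∘ Ciphering.φ (L (end π) i)

  embed-embedding : (π : Path) → Embedding (subtree (s (end π))) t (comp π) (embed π)
  embed-embedding [] = subst-embedding s-S≡here
  embed-embedding (π ▷ i) =
    ∘-embedding (embed-embedding π)
      (∘-embedding (descend-embedding (s (end π)) i) (ciphering-embedding (L (end π) i)))

  Ψ : Path → Pos t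
  Ψ π = embed π here

  Ψ-[] : Ψ [] ≡ here
  Ψ-[] = subst-here s-S≡here

  Ψ-▷ : ∀ π i → Ψ (π ▷ i) ≡ embed π (childPos {t = subtree (s (end π))} here i)
  Ψ-▷ π i = cong (embed π) (trans (cong (descend (s (end π)) i) (ciphering-here (L (end π) i)))
                                   (descend-here (s (end π)) i))

  Ψ-▷-child : ∀ π i → ChildOf (Ψ (π ▷ i)) (Ψ π)
  Ψ-▷-child π i = subst (λ v → ChildOf v (Ψ π)) (sym (Ψ-▷ π i))
    (preserves-child (embed-embedding π) (i , refl))

  Ψ-lifts-child : ∀ π {v} → ChildOf v (Ψ π) → Σ (Fin (arity (s (end π)))) λ i → Ψ (π ▷ i) ≡ v
  Ψ-lifts-child π v∈Ψπ =
    let (w , (i , i-th≡w) , embed-w≡v) = lifts-child (embed-embedding π) v∈Ψπ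
    in i , trans (Ψ-▷ π i) (trans (cong (embed π) i-th≡w) embed-w≡v)

  Ψ-injective : ∀ π ρ → Ψ π ≡ Ψ ρ → π ≡ ρ
  Ψ-injective [] [] _ = refl
  Ψ-injective [] (ρ ▷ j) e =
    let (k , e′) = Ψ-▷-child ρ j
    in ⊥-elim (childPos≢here (Ψ ρ) k (trans e′ (trans (sym e) Ψ-[])))
  Ψ-injective (π ▷ i) [] e =
    let (k , e′) = Ψ-▷-child π i
    in ⊥-elim (childPos≢here (Ψ π) k (trans e′ (trans e Ψ-[])))
  Ψ-injective (π ▷ i) (ρ ▷ j) e
    with (k , e₁) ← Ψ-▷-child π i | (k′ , e₂) ← Ψ-▷-child ρ j
    with Ψ-injective π ρ (childPos-injectiveˡ (Ψ π) (Ψ ρ) k k′ (trans e₁ (trans e (sym e₂))))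
  ... | refl = cong (π ▷_) (childPos-injectiveʳ here i j
                 (injective (embed-embedding π) (trans (sym (Ψ-▷ π i)) (trans e (Ψ-▷ π j)))))

  Ψ-onto : ∀ {u} → Descent u → Σ Path λ π → Ψ π ≡ u
  Ψ-onto from-root = [] , Ψ-[]
  Ψ-onto (_▷_ {u} d i) =
    let (π , Ψπ≡u) = Ψ-onto d
        (k , Ψπk≡ui) = Ψ-lifts-child π (subst (ChildOf (childPos u i)) (sym Ψπ≡u) (i , refl))
    in π ▷ k , Ψπk≡ui

  Ψ-bijection : Path ⤖ Pos t
  Ψ-bijection = mk⤖ {to = Ψ} (Ψ-injective _ _ , λ u →
    let (π , Ψπ≡u) = Ψ-onto (descent u) in π , λ { refl → Ψπ≡u })

  Ψ-child⇔ : ∀ π ρ → ChildHat ρ π ⇔ ChildOf (Ψ ρ) (Ψ π)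
  Ψ-child⇔ π ρ = mk⇔ (λ { (i , refl) → Ψ-▷-child π i })
    λ ρ∈π → let (i , Ψπi≡Ψρ) = Ψ-lifts-child π ρ∈π in i , Ψ-injective (π ▷ i) ρ Ψπi≡Ψρ

  labHat≡lab∘Ψ : ∀ π → labHat π ≡ lab (Ψ π)
  labHat≡lab∘Ψ π = sym (relabels (embed-embedding π) here)

theorem2 : {A : Set} (t : Tree A) {V : Set} (cls : Pos t → V)
    → (∀ p → ∃ λ u → cls u ≡ p)
    → (∀ u v → (cls u ≡ cls v) ⇔ Ciphering (subtree u) (subtree v))
    → (s : V → Pos t)
    → (∀ a b → s a ≡ s b → a ≡ b)
    → (∀ a → cls (s a) ≡ a)
    → (∀ q → q ≢ cls (root t) → ∃ λ p → GEdge t cls p q × ChildOf (s q) (s p))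
    → (L : Choice t cls s)
    → (∀ p i → childPos (s p) i ≡ s (cls (childPos (s p) i))
         → ∀ (w : Pos (subtree (s (cls (childPos (s p) i)))))
         → Ciphering.cipher (L p i) (lab w) ≡ lab w)
    → Σ (Unfold.Path t cls s L ⤖ Pos t) λ Ψ
        → (∀ π ρ → Unfold.ChildHat t cls s L ρ π
                     ⇔ ChildOf (Bijection.to Ψ ρ) (Bijection.to Ψ π))
        × (∀ π → Unfold.labHat t cls s L π ≡ lab (Bijection.to Ψ π))
theorem2 t cls _ cls≡⇔ciphering s _ cls∘s _ L _ = Ψ-bijection , Ψ-child⇔ , labHat≡lab∘Ψ
  where open Unfolding t cls cls≡⇔ciphering s cls∘s L
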